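{- Let $\mathcal{B}$ be a finite relational structure with domain $B$, $|B|\geq 2$. Suppose $g$ is a she of $\mathcal{B}$ for which there are $b\in B$ and sets $B',B''$ such that $\{b\},B',B''$ are pairwise disjoint with union $B$, $B'\neq\emptyset$, $g(b)=B$, $g(x)=\{x\}$ for all $x\in B'$, and for every $x\in B''$ there is $y\in B'$ with $g(x)=\{y\}$. Let $\varphi(u,\mathbf{v})$ be a formula of $\{\exists,\forall,\wedge,\vee\}$-FO, where $\mathbf{v}$ has arity $k$. Then for all $\mathbf{x}=(x_1,\dots,x_k)\in(B'\cup\{b\})^k$: (I) if $\mathcal{B}\models\varphi(b,\mathbf{x})$ then $\mathcal{B}\models\forall u\,\varphi(u,\mathbf{x})$; (II) if $\mathcal{B}\models\exists u\,\varphi(u,\mathbf{x})$ then there is $u\in B'$ with $\mathcal{B}\models\varphi(u,\mathbf{x})$.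
   Context: $\{\exists,\forall,\wedge,\vee\}$-FO is the set of first-order formulas over the signature of $\mathcal{B}$ built from relational atoms using only $\wedge,\vee,\exists,\forall$ (no equality, no negation). A shop on $B$ is a map $f:B\to\mathfrak{P}(B)\setminus\{\emptyset\}$ with every $y\in B$ in some $f(x)$; a she of $\mathcal{B}$ is a shop $f$ such that for each relation $R$ of $\mathcal{B}$, $\mathcal{B}\models R(x_1,\dots,x_i)$ implies $\mathcal{B}\models R(y_1,\dots,y_i)$ for all $y_j\in f(x_j)$. -}

module Defs where

open import Data.Nat using (ℕ; suc)
open import Data.Fin using (Fin; zero)
open import Data.Bool using (Bool; true)
open import Data.Product using (Σ; ∃; _×_)
open import Data.Sum using (_⊎_)
open import Data.Fin.Subset using (Subset; _∈_; Nonempty)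
open import Data.Vec.Functional using (_∷_)
open import Relation.Binary.PropositionalEquality using (_≡_)

record Structure : Set where
  field
    size  : ℕ
    nRels : ℕ
    arity : Fin nRels → ℕ
    rel   : (r : Fin nRels) → (Fin (arity r) → Fin size) → Bool

open Structure public

Holds : (𝓑 : Structure) (r : Fin (nRels 𝓑)) → (Fin (arity 𝓑 r) → Fin (size 𝓑)) → Set
Holds 𝓑 r as = rel 𝓑 r as ≡ true

-- {∃,∀,∧,∨}-FO formulas over the signature of 𝓑 with free variables Fin v
-- (de Bruijn: a quantifier binds variable zero).  No equality, no negation.
data Formula (𝓑 : Structure) (v : ℕ) : Set where
  atom : (r : Fin (nRels 𝓑)) → (Fin (arity 𝓑 r) → Fin v) → Formula 𝓑 v
  _∧'_ : Formula 𝓑 v → Formula 𝓑 v → Formula 𝓑 v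
  _∨'_ : Formula 𝓑 v → Formula 𝓑 v → Formula 𝓑 v
  ∃'   : Formula 𝓑 (suc v) → Formula 𝓑 v
  ∀'   : Formula 𝓑 (suc v) → Formula 𝓑 v

Sat : (𝓑 : Structure) {v : ℕ} → Formula 𝓑 v → (Fin v → Fin (size 𝓑)) → Set
Sat 𝓑 (atom r ts) env = Holds 𝓑 r (λ j → env (ts j))
Sat 𝓑 (φ ∧' ψ) env = Sat 𝓑 φ env × Sat 𝓑 ψ env
Sat 𝓑 (φ ∨' ψ) env = Sat 𝓑 φ env ⊎ Sat 𝓑 ψ env
Sat 𝓑 (∃' φ) env = Σ (Fin (size 𝓑)) (λ a → Sat 𝓑 φ (a ∷ env))
Sat 𝓑 (∀' φ) env = (a : Fin (size 𝓑)) → Sat 𝓑 φ (a ∷ env)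

IsShop : {n : ℕ} → (Fin n → Subset n) → Set
IsShop {n} f = ((x : Fin n) → Nonempty (f x)) × ((y : Fin n) → ∃ (λ x → y ∈ f x))

IsShe : (𝓑 : Structure) → (Fin (size 𝓑) → Subset (size 𝓑)) → Set
IsShe 𝓑 f = IsShop f ×
  ((r : Fin (nRels 𝓑)) (xs ys : Fin (arity 𝓑 r) → Fin (size 𝓑)) →
     Holds 𝓑 r xs → ((j : Fin (arity 𝓑 r)) → ys j ∈ f (xs j)) → Holds 𝓑 r ys)

-- A she g maps satisfying assignments to satisfying assignments: replacing each
-- value a by any c ∈ g a preserves every {∃,∀,∧,∨}-FO formula, since atoms are
-- preserved by definition, ∃ is carried along because g(a) is nonempty, and ∀
-- because every element lies in some g(a).  The parameters xs lie in B′ ∪ {b},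
-- where x ∈ g x, so they may stay put.  For (I) move u from b to any element,
-- as g(b) = B.  For (II) a witness u is moved into B′: from b to any element of
-- B′, from B″ to the unique y ∈ B′ with g(u) = {y}.
module Submission where

open import Defs
open import Data.Nat using (ℕ; suc; _≤_)
open import Data.Fin using (Fin; zero; suc)
open import Data.Product using (Σ; _×_; _,_; proj₁; proj₂)
open import Data.Sum using (_⊎_; inj₁; inj₂)
open import Data.Fin.Subset using (Subset; _∈_; _∉_; Nonempty; ⊤; ⁅_⁆)
open import Data.Fin.Subset.Properties using (∈⊤; x∈⁅x⁆)
open import Data.Vec.Functional using (_∷_)
open import Relation.Binary.PropositionalEquality using (_≡_; refl; sym; subst)

IsImage : ∀ {n v} → (Fin n → Subset n) → (Fin v → Fin n) → (Fin v → Fin n) → Set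
IsImage g e e′ = ∀ i → e′ i ∈ g (e i)

∷-isImage : ∀ {n v} {g : Fin n → Subset n} {a c : Fin n} {e e′ : Fin v → Fin n} →
            c ∈ g a → IsImage g e e′ → IsImage g (a ∷ e) (c ∷ e′)
∷-isImage c∈ga _   zero    = c∈ga
∷-isImage _    e′⊆ (suc i) = e′⊆ i

module _ {𝓑 : Structure} {g : Fin (size 𝓑) → Subset (size 𝓑)} (she : IsShe 𝓑 g) where

  she-preserves-Sat : ∀ {v} (φ : Formula 𝓑 v) {e e′ : Fin v → Fin (size 𝓑)} →
                      IsImage g e e′ → Sat 𝓑 φ e → Sat 𝓑 φ e′
  she-preserves-Sat (atom r ts) e′⊆ s = proj₂ she r _ _ s (λ j → e′⊆ (ts j))
  she-preserves-Sat (φ ∧' ψ) e′⊆ (s , t) =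
    she-preserves-Sat φ e′⊆ s , she-preserves-Sat ψ e′⊆ t
  she-preserves-Sat (φ ∨' ψ) e′⊆ (inj₁ s) = inj₁ (she-preserves-Sat φ e′⊆ s)
  she-preserves-Sat (φ ∨' ψ) e′⊆ (inj₂ t) = inj₂ (she-preserves-Sat ψ e′⊆ t)
  she-preserves-Sat (∃' φ) e′⊆ (a , s) =
    let c , c∈ga = proj₁ (proj₁ she) a
    in  c , she-preserves-Sat φ (∷-isImage {g = g} c∈ga e′⊆) s
  she-preserves-Sat (∀' φ) e′⊆ s c =
    let a , c∈ga = proj₂ (proj₁ she) c
    in  she-preserves-Sat φ (∷-isImage {g = g} c∈ga e′⊆) (s a)

  she-moves-head : ∀ {v} (φ : Formula 𝓑 (suc v)) {xs : Fin v → Fin (size 𝓑)} {a c : Fin (size 𝓑)} →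
                   IsImage g xs xs → c ∈ g a → Sat 𝓑 φ (a ∷ xs) → Sat 𝓑 φ (c ∷ xs)
  she-moves-head φ xs⊆ c∈ga = she-preserves-Sat φ (∷-isImage {g = g} c∈ga xs⊆)

∈-by-≡ : ∀ {n} {x : Fin n} {p q : Subset n} → p ≡ q → x ∈ q → x ∈ p
∈-by-≡ {x = x} p≡q = subst (x ∈_) (sym p≡q)

-- Of the hypotheses on B′ and B″ only the covering, B′ ≠ ∅ and the values of g
-- are needed; |B| ≥ 2 and the disjointness conditions are not.
lemma3p7 : (𝓑 : Structure) → 2 ≤ size 𝓑 →
    (g : Fin (size 𝓑) → Subset (size 𝓑)) → IsShe 𝓑 g →
    (b : Fin (size 𝓑)) (B′ B″ : Subset (size 𝓑)) →
    b ∉ B′ → b ∉ B″ → ((x : Fin (size 𝓑)) → x ∈ B′ → x ∉ B″) →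
    ((x : Fin (size 𝓑)) → (x ≡ b) ⊎ (x ∈ B′) ⊎ (x ∈ B″)) →
    Nonempty B′ →
    g b ≡ ⊤ →
    ((x : Fin (size 𝓑)) → x ∈ B′ → g x ≡ ⁅ x ⁆) →
    ((x : Fin (size 𝓑)) → x ∈ B″ → Σ (Fin (size 𝓑)) (λ y → y ∈ B′ × g x ≡ ⁅ y ⁆)) →
    (k : ℕ) (φ : Formula 𝓑 (suc k)) (xs : Fin k → Fin (size 𝓑)) →
    ((i : Fin k) → (xs i ∈ B′) ⊎ (xs i ≡ b)) →
    ((Sat 𝓑 φ (b ∷ xs) → (u : Fin (size 𝓑)) → Sat 𝓑 φ (u ∷ xs))
    × (Σ (Fin (size 𝓑)) (λ u → Sat 𝓑 φ (u ∷ xs)) →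
    Σ (Fin (size 𝓑)) (λ u → u ∈ B′ × Sat 𝓑 φ (u ∷ xs))))
lemma3p7 𝓑 _ g she b B′ B″ _ _ _ cover (u₀ , u₀∈B′) gb≡⊤ gB′ gB″ k φ xs xs∈B′∪b = I , II
  where
  xs-fixed : IsImage g xs xs
  xs-fixed i with xs∈B′∪b i
  ... | inj₁ xᵢ∈B′ = ∈-by-≡ (gB′ (xs i) xᵢ∈B′) (x∈⁅x⁆ (xs i))
  ... | inj₂ refl  = ∈-by-≡ gb≡⊤ ∈⊤

  I : Sat 𝓑 φ (b ∷ xs) → (u : Fin (size 𝓑)) → Sat 𝓑 φ (u ∷ xs)
  I s u = she-moves-head she φ xs-fixed (∈-by-≡ gb≡⊤ ∈⊤) s

  II : Σ (Fin (size 𝓑)) (λ u → Sat 𝓑 φ (u ∷ xs)) →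
       Σ (Fin (size 𝓑)) (λ u → u ∈ B′ × Sat 𝓑 φ (u ∷ xs))
  II (u , s) with cover u
  ... | inj₁ refl         = u₀ , u₀∈B′ , I s u₀
  ... | inj₂ (inj₁ u∈B′) = u , u∈B′ , s
  ... | inj₂ (inj₂ u∈B″) with gB″ u u∈B″
  ...   | y , y∈B′ , gu≡⁅y⁆ =
    y , y∈B′ , she-moves-head she φ xs-fixed (∈-by-≡ gu≡⁅y⁆ (x∈⁅x⁆ y)) s
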